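{- Let $G=(V,E)$ be a connected simple bridgeless triangle-free cubic graph and $\lambda$ a valid labeling of $\mathfrak{L}_2(G)$ with set of open-edge cycles $\Gamma_\lambda$. Let $\mathfrak{G}_\lambda$ be the graph with vertex set $\Gamma_\lambda$ in which $\gamma,\phi\in\Gamma_\lambda$ (possibly $\gamma=\phi$, giving a loop) are joined by a single edge iff $\gamma$ and $\phi$ are adjacent. Then $\mathfrak{G}_\lambda$ is a simple graph with (possibly) loops, and it is connected.
   Context: Line graph $\mathcal{L}(H)$: vertex set $E(H)$, two edges adjacent iff they share exactly one endpoint. For each triangle $T$ of $\mathcal{L}(G)$ its three edges span a triangle in $\mathcal{L}(\mathcal{L}(G))$; $\mathfrak{L}_2(G)$ is $\mathcal{L}(\mathcal{L}(G))$ with all edges of all these triangles deleted. Reduced cliques: for each $x\in E$ the four edges of $\mathcal{L}(G)$ incident to $x$ form a $K_4$ in $\mathcal{L}(\mathcal{L}(G))$; the reduced clique $\mathbb{X}_x$ is this $K_4$ minus the deleted edges. A labeling $\lambda:E(\mathfrak{L}_2(G))\to\{0,1\}$ (1 = open, 0 = closed) is valid if for every reduced clique $\mathbb{X}$ and every vertex $v$ of $\mathbb{X}$ there are vertices $w,u\neq v$ of $\mathbb{X}$ with $\langle v,w\rangle,\langle v,u\rangle\in E(\mathbb{X})$ and $\lambda_{\langle v,w\rangle}=1-\lambda_{\langle v,u\rangle}$. The open edges form a disjoint union of cycles, whose set is $\Gamma_\lambda$. Two cycles $\gamma_1,\gamma_2\in\Gamma_\lambda$ are adjacent if there is a reduced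 clique $\mathbb{X}$ and edges $e_1\in\gamma_1$, $e_2\in\gamma_2$ with $e_1,e_2\in\mathbb{X}$. -}

module Defs where

open import Data.Nat using (ℕ)
open import Data.Fin using (Fin)
open import Data.Bool using (Bool; true; false; not)
open import Data.Product using (Σ; Σ-syntax; ∃; _×_; _,_; proj₁; proj₂)
open import Data.Sum using (_⊎_)
open import Relation.Nullary using (¬_)
open import Relation.Binary.PropositionalEquality using (_≡_)
open import Relation.Binary.Construct.Closure.ReflexiveTransitive using (Star)

-- Graphs given by a vertex setoid and an adjacency relation.
-- (Iterated line graphs have unordered pairs as vertices; we represent an
--  unordered pair by an ordered one and identify the two orientations via ≈.)

record Graph : Set₁ where
  constructor mkGraph
  field
    V   : Set
    _≈_ : V → V → Set
    _~_ : V → V → Set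

open Graph public

Edge : Graph → Set
Edge H = Σ (V H × V H) (λ p → _~_ H (proj₁ p) (proj₂ p))

_∈ₑ_[_] : {H : Graph} → V H → Edge H → Set
_∈ₑ_[_] {H} x ((a , b) , _) = _≈_ H x a ⊎ _≈_ H x b

LineGraph : Graph → Graph
LineGraph H = mkGraph (Edge H) eq adj
  where
  eq : Edge H → Edge H → Set
  eq ((a , b) , _) ((c , d) , _) =
    (_≈_ H a c × _≈_ H b d) ⊎ (_≈_ H a d × _≈_ H b c)
  adj : Edge H → Edge H → Set
  adj e f = Σ (V H) λ x → (_∈ₑ_[_] {H} x e × _∈ₑ_[_] {H} x f)
              × (∀ y → _∈ₑ_[_] {H} y e → _∈ₑ_[_] {H} y f → _≈_ H y x)

Triangle : Graph → Set
Triangle H = Σ (V H) λ p → Σ (V H) λ q → Σ (V H) λ r →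
  _~_ H p q × _~_ H q r × _~_ H p r

VertexOfTri : (H : Graph) → Triangle H → V H → Set
VertexOfTri H (p , q , r , _) y = _≈_ H y p ⊎ _≈_ H y q ⊎ _≈_ H y r

EdgeOfTri : (H : Graph) → Triangle H → Edge H → Set
EdgeOfTri H T ((a , b) , _) = VertexOfTri H T a × VertexOfTri H T b

Deleted : (G : Graph) → V (LineGraph (LineGraph G)) → V (LineGraph (LineGraph G)) → Set
Deleted G P Q = Σ (Triangle (LineGraph G)) λ T →
  EdgeOfTri (LineGraph G) T P × EdgeOfTri (LineGraph G) T Q

𝔏₂ : Graph → Graph
𝔏₂ G = mkGraph (V LLG) (_≈_ LLG) (λ P Q → _~_ LLG P Q × ¬ Deleted G P Q)
  where LLG = LineGraph (LineGraph G)

InClique : (G : Graph) → Edge G → V (𝔏₂ G) → Set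
InClique G x P = _∈ₑ_[_] {LineGraph G} x P

EdgeInClique : (G : Graph) → Edge G → Edge (𝔏₂ G) → Set
EdgeInClique G x ((P , Q) , _) = InClique G x P × InClique G x Q

-- labelings of E(𝔏₂(G)); true = 1 = open, false = 0 = closed

Labeling : Graph → Set
Labeling G = Edge (𝔏₂ G) → Bool

-- a labeling must be a function of the (unordered) edge
WellDefined : (G : Graph) → Labeling G → Set
WellDefined G lab = ∀ e f → _≈_ (LineGraph (𝔏₂ G)) e f → lab e ≡ lab f

Valid : (G : Graph) → Labeling G → Set
Valid G lab = ∀ (x : Edge G) (v : V (𝔏₂ G)) → InClique G x v →
  Σ (V (𝔏₂ G)) λ w → Σ (V (𝔏₂ G)) λ u →
    InClique G x w × InClique G x u ×
    ¬ _≈_ (𝔏₂ G) w v × ¬ _≈_ (𝔏₂ G) u v ×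
    Σ (_~_ (𝔏₂ G) v w) λ hw → Σ (_~_ (𝔏₂ G) v u) λ hu →
      lab ((v , w) , hw) ≡ not (lab ((v , u) , hu))

Open : (G : Graph) → Labeling G → Edge (𝔏₂ G) → Set
Open G lab e = lab e ≡ true

Touch : (G : Graph) → Labeling G → Edge (𝔏₂ G) → Edge (𝔏₂ G) → Set
Touch G lab e f = Open G lab e × Open G lab f ×
  Σ (V (𝔏₂ G)) λ y → _∈ₑ_[_] {𝔏₂ G} y e × _∈ₑ_[_] {𝔏₂ G} y f

-- two open edges lie on the same cycle of Γ_λ (same component of the
-- open subgraph, which is a disjoint union of cycles)
SameCycle : (G : Graph) → Labeling G → Edge (𝔏₂ G) → Edge (𝔏₂ G) → Set
SameCycle G lab = Star (Touch G lab)

OpenEdge : (G : Graph) → Labeling G → Set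
OpenEdge G lab = Σ (Edge (𝔏₂ G)) (Open G lab)

CycleAdj : (G : Graph) (lab : Labeling G) → OpenEdge G lab → OpenEdge G lab → Set
CycleAdj G lab (γ₁ , _) (γ₂ , _) = Σ (Edge G) λ x →
  Σ (OpenEdge G lab) λ e₁ → Σ (OpenEdge G lab) λ e₂ →
    SameCycle G lab γ₁ (proj₁ e₁) × SameCycle G lab γ₂ (proj₁ e₂) ×
    EdgeInClique G x (proj₁ e₁) × EdgeInClique G x (proj₁ e₂)

-- the cycle graph 𝔊_λ: vertices = cycles of Γ_λ, i.e. open edges up to
-- lying on the same cycle; adjacency as above (loops allowed)
CycleGraph : (G : Graph) → Labeling G → Graph
CycleGraph G lab = mkGraph (OpenEdge G lab)
  (λ e f → SameCycle G lab (proj₁ e) (proj₁ f)) (CycleAdj G lab)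

Step : (H : Graph) → V H → V H → Set
Step H a b = _≈_ H a b ⊎ _~_ H a b

Connected : Graph → Set
Connected H = V H × (∀ u v → Star (Step H) u v)

FinGraph : (n : ℕ) → (Fin n → Fin n → Bool) → Graph
FinGraph n adj = mkGraph (Fin n) _≡_ (λ u v → adj u v ≡ true)

Simple : (n : ℕ) → (Fin n → Fin n → Bool) → Set
Simple n adj = (∀ u v → adj u v ≡ adj v u) × (∀ v → adj v v ≡ false)

Cubic : (n : ℕ) → (Fin n → Fin n → Bool) → Set
Cubic n adj = ∀ v → Σ (Fin n) λ a → Σ (Fin n) λ b → Σ (Fin n) λ c →
  ¬ a ≡ b × ¬ a ≡ c × ¬ b ≡ c ×
  adj v a ≡ true × adj v b ≡ true × adj v c ≡ true ×
  (∀ w → adj v w ≡ true → w ≡ a ⊎ w ≡ b ⊎ w ≡ c)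

TriangleFree : (n : ℕ) → (Fin n → Fin n → Bool) → Set
TriangleFree n adj = ∀ a b c →
  ¬ (adj a b ≡ true × adj b c ≡ true × adj a c ≡ true)

Bridge : (n : ℕ) → (Fin n → Fin n → Bool) → Fin n → Fin n → Set
Bridge n adj u v = adj u v ≡ true ×
  ¬ Star (λ a b → adj a b ≡ true ×
                  ¬ ((a ≡ u × b ≡ v) ⊎ (a ≡ v × b ≡ u))) u v

Bridgeless : (n : ℕ) → (Fin n → Fin n → Bool) → Set
Bridgeless n adj = ∀ u v → ¬ Bridge n adj u v

{-# OPTIONS --safe #-}
module Submission where

-- Every reduced clique 𝕏ₓ contains an open edge: validity at any of its
-- vertices offers two clique edges with opposite labels. If x and y are edges
-- of G at a common vertex a, the vertex {x, y} of 𝔏₂(G) lies in both 𝕏ₓ and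
-- 𝕏_y, and validity there yields open edges of both cliques through {x, y};
-- these lie on one cycle. So the cycles meeting 𝕏ₓ and 𝕏_y are joined in 𝔊_λ,
-- and following a walk of the connected graph G joins any two cliques, hence
-- any two cycles.

open import Defs
open import Data.Nat using (ℕ)
open import Data.Fin using (Fin; _≟_)
open import Data.Bool using (Bool; true; false)
open import Data.Bool.Properties using (not-injective)
open import Data.Product using (Σ; _×_; _,_; proj₁; proj₂)
open import Data.Sum using (inj₁; inj₂) renaming (map to ⊎-map)
open import Data.Empty using (⊥-elim)
open import Relation.Nullary using (¬_; yes; no)
open import Relation.Binary.PropositionalEquality using (_≡_; refl; sym; trans)
open import Relation.Binary.Construct.Closure.ReflexiveTransitive using (Star; ε; _◅_; _◅◅_)

LineGraph-refl : (H : Graph) → (∀ a → _≈_ H a a) → ∀ e → _≈_ (LineGraph H) e e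
LineGraph-refl H ≈-refl ((a , b) , _) = inj₁ (≈-refl a , ≈-refl b)

LineGraph-≈-swap : (H : Graph) {a b : V H} {h : _~_ H a b} {h′ : _~_ H b a} (e : Edge H) →
  _≈_ (LineGraph H) ((a , b) , h) e → _≈_ (LineGraph H) ((b , a) , h′) e
LineGraph-≈-swap H _ (inj₁ (p , q)) = inj₂ (q , p)
LineGraph-≈-swap H _ (inj₂ (p , q)) = inj₁ (q , p)

module _ (G : Graph) where

  InClique-swap : {a b : V G} {h : _~_ G a b} {h′ : _~_ G b a} (P : V (𝔏₂ G)) →
    InClique G ((a , b) , h) P → InClique G ((b , a) , h′) P
  InClique-swap {h = h} {h′} ((X , Y) , _) =
    ⊎-map (LineGraph-≈-swap G {h = h} {h′} X) (LineGraph-≈-swap G {h = h} {h′} Y)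

  EdgeInClique-swap : {a b : V G} {h : _~_ G a b} {h′ : _~_ G b a} (e : Edge (𝔏₂ G)) →
    EdgeInClique G ((a , b) , h) e → EdgeInClique G ((b , a) , h′) e
  EdgeInClique-swap {h = h} {h′} ((P , Q) , _) (p , q) =
    InClique-swap {h = h} {h′} P p , InClique-swap {h = h} {h′} Q q

  edge-in-some-clique : (e : Edge (𝔏₂ G)) → Σ (Edge G) λ x → EdgeInClique G x e
  edge-in-some-clique (_ , ((x , ends , _) , _)) = x , ends

  module _ (≈-refl : ∀ a → _≈_ G a a) (lab : Labeling G) (valid : Valid G lab) where

    𝔏₂-refl : ∀ P → _≈_ (𝔏₂ G) P P
    𝔏₂-refl = LineGraph-refl (LineGraph G) (LineGraph-refl G ≈-refl)

    open-edge-at : ∀ x v → InClique G x v →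
      Σ (OpenEdge G lab) λ f → EdgeInClique G x (proj₁ f) × _∈ₑ_[_] {𝔏₂ G} v (proj₁ f)
    open-edge-at x v v∈x with valid x v v∈x
    ... | w , u , w∈x , u∈x , _ , _ , v~w , v~u , opposite with lab ((v , w) , v~w) in λvw
    ... | true  = (((v , w) , v~w) , λvw) , (v∈x , w∈x) , inj₁ (𝔏₂-refl v)
    ... | false = (((v , u) , v~u) , not-injective (sym opposite)) , (v∈x , u∈x) , inj₁ (𝔏₂-refl v)

Cubic⇒other-neighbour : ∀ {n} {adj : Fin n → Fin n → Bool} → Cubic n adj →
  ∀ a b → Σ (Fin n) λ c → adj a c ≡ true × ¬ b ≡ c
Cubic⇒other-neighbour cubic a b with cubic a
... | p , q , _ , p≢q , _ , _ , a~p , a~q , _ with b ≟ p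
...   | yes refl = q , a~q , p≢q
...   | no b≢p   = p , a~p , b≢p

module _ {n : ℕ} (adj : Fin n → Fin n → Bool) (lab : Labeling (FinGraph n adj))
         (valid : Valid (FinGraph n adj) lab) where

  private
    G = FinGraph n adj
    𝔊 = CycleGraph G lab

  corner : ∀ {a b c} (hb : adj a b ≡ true) (hc : adj a c ≡ true) → ¬ b ≡ c → V (𝔏₂ G)
  corner {a} {b} {c} hb hc b≢c =
    (((a , b) , hb) , ((a , c) , hc)) , a , (inj₁ refl , inj₁ refl) , only-a
    where
    only-a : ∀ t → _∈ₑ_[_] {G} t ((a , b) , hb) → _∈ₑ_[_] {G} t ((a , c) , hc) → t ≡ a
    only-a t (inj₁ t≡a) _          = t≡a
    only-a t (inj₂ _)   (inj₁ t≡a) = t≡a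
    only-a t (inj₂ t≡b) (inj₂ t≡c) = ⊥-elim (b≢c (trans (sym t≡b) t≡c))

  open-edge-in-clique : ∀ {a b c} (hb : adj a b ≡ true) (hc : adj a c ≡ true) → ¬ b ≡ c →
    Σ (OpenEdge G lab) λ f → EdgeInClique G ((a , b) , hb) (proj₁ f)
  open-edge-in-clique {a} {b} hb hc b≢c
    with open-edge-at G (λ _ → refl) lab valid ((a , b) , hb) (corner hb hc b≢c)
           (inj₁ (inj₁ (refl , refl)))
  ... | f , f∈x , _ = f , f∈x

  open-edges-touch-at-corner : ∀ {a b c} (hb : adj a b ≡ true) (hc : adj a c ≡ true) → ¬ b ≡ c →
    Σ (OpenEdge G lab) λ f → Σ (OpenEdge G lab) λ g →
      EdgeInClique G ((a , b) , hb) (proj₁ f) × EdgeInClique G ((a , c) , hc) (proj₁ g) ×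
      Touch G lab (proj₁ f) (proj₁ g)
  open-edges-touch-at-corner {a} {b} {c} hb hc b≢c
    with open-edge-at G (λ _ → refl) lab valid ((a , b) , hb) (corner hb hc b≢c)
           (inj₁ (inj₁ (refl , refl)))
       | open-edge-at G (λ _ → refl) lab valid ((a , c) , hc) (corner hb hc b≢c)
           (inj₂ (inj₁ (refl , refl)))
  ... | f , f∈x , v∈f | g , g∈y , v∈g =
    f , g , f∈x , g∈y , proj₂ f , proj₂ g , corner hb hc b≢c , v∈f , v∈g

  Joined : Edge G → Edge G → Set
  Joined x y = ∀ (f g : OpenEdge G lab) →
    EdgeInClique G x (proj₁ f) → EdgeInClique G y (proj₁ g) → Star (Step 𝔊) f g

  Joined-trans : ∀ {x y z} → Σ (OpenEdge G lab) (λ h → EdgeInClique G y (proj₁ h)) →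
    Joined x y → Joined y z → Joined x z
  Joined-trans (h , h∈y) x⇝y y⇝z f g f∈x g∈z = x⇝y f h f∈x h∈y ◅◅ y⇝z h g h∈y g∈z

  cliques-at-vertex-joined : ∀ {a b c} (hb : adj a b ≡ true) (hc : adj a c ≡ true) →
    Joined ((a , b) , hb) ((a , c) , hc)
  cliques-at-vertex-joined {a} {b} {c} hb hc f g f∈x g∈y with b ≟ c
  ... | yes refl = inj₂ (((a , b) , hb) , f , g , ε , ε , f∈x , g∈y) ◅ ε
  ... | no b≢c with open-edges-touch-at-corner hb hc b≢c
  ... | f′ , g′ , f′∈x , g′∈y , touch =
    _◅_ {j = f′} (inj₂ (((a , b) , hb) , f , f′ , ε , ε , f∈x , f′∈x))
    (_◅_ {j = g′} (inj₁ (touch ◅ ε))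
    (inj₂ (((a , c) , hc) , g′ , g , ε , ε , g′∈y , g∈y) ◅ ε))

  walk⇒Joined : Cubic n adj → (∀ u v → adj u v ≡ adj v u) → ∀ {a c} → Star (Step G) a c →
    ∀ {b d} (hb : adj a b ≡ true) (hd : adj c d ≡ true) → Joined ((a , b) , hb) ((c , d) , hd)
  walk⇒Joined cubic adj-sym ε hb hd = cliques-at-vertex-joined hb hd
  walk⇒Joined cubic adj-sym (inj₁ refl ◅ walk) = walk⇒Joined cubic adj-sym walk
  walk⇒Joined cubic adj-sym {a} {c} (_◅_ {j = a′} (inj₂ a~a′) walk) {b} {d} hb hd
    with Cubic⇒other-neighbour cubic a a′
  ... | e , a~e , a′≢e =
    Joined-trans {(a , b) , hb} {(a , a′) , a~a′} {(c , d) , hd}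
      (open-edge-in-clique a~a′ a~e a′≢e) (cliques-at-vertex-joined hb a~a′)
      λ f g f∈x g∈y → walk⇒Joined cubic adj-sym walk a′~a hd f g
        (EdgeInClique-swap G {h = a~a′} {a′~a} (proj₁ f) f∈x) g∈y
    where a′~a = trans (adj-sym a′ a) a~a′

lemma2p11 : (n : ℕ) (adj : Fin n → Fin n → Bool) →
    Simple n adj → Connected (FinGraph n adj) → Bridgeless n adj →
    TriangleFree n adj → Cubic n adj →
    (lab : Labeling (FinGraph n adj)) →
    WellDefined (FinGraph n adj) lab → Valid (FinGraph n adj) lab →
    Connected (CycleGraph (FinGraph n adj) lab)
lemma2p11 n adj (adj-sym , _) (v₀ , walk) _ _ cubic lab _ valid = some-cycle , joined
  where
  G = FinGraph n adj

  some-cycle : OpenEdge G lab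
  some-cycle with cubic v₀
  ... | _ , _ , _ , p≢q , _ , _ , v₀~p , v₀~q , _ =
    proj₁ (open-edge-in-clique adj lab valid v₀~p v₀~q p≢q)

  joined : ∀ f g → Star (Step (CycleGraph G lab)) f g
  joined f g with edge-in-some-clique G (proj₁ f) | edge-in-some-clique G (proj₁ g)
  ... | ((a , _) , hb) , f∈x | ((c , _) , hd) , g∈y =
    walk⇒Joined adj lab valid cubic adj-sym (walk a c) hb hd f g f∈x g∈y
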